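{- For no choice of a natural number $k$ and nonnegative numbers $p_1,\dots,p_k$ with $p_1+\dots+p_k=1$ does the algorithm $\mathrm{MinIndex}(k,p_1,\dots,p_k)$ achieve a guarantee larger than $5/9$ on forests of maximum degree three in the adversarial edge arrival model.
   Context: Adversarial edge arrival model: the edges of a graph arrive one at a time in an order chosen by an adversary. The algorithm $\mathrm{MinIndex}(k,p_1,\dots,p_k)$ (with $k$ a natural number and $p_i \geq 0$, $\sum_i p_i = 1$) maintains $k$ matchings $M_1,\dots,M_k$, initially empty. When an edge $e$ arrives, if $M_i \cup \{e\}$ is not a matching for every $i=1,\dots,k$, then $e$ is rejected; otherwise $e$ is added to $M_i$ where $i$ is the minimal index such that $M_i \cup \{e\}$ is a matching. At any timepoint, the output is the matching $M_i$ with probability $p_i$. The algorithm achieves guarantee $\gamma$ on a class of graphs if for every graph in the class and every arrival order, at every timepoint the expected cardinality $\sum_i p_i |M_i|$ of the output is at least $\gamma$ times the maximum cardinality of a matching in the graph formed by the already arrived edges. "Forests of maximum degree three" are acyclic graphs in which every vertex has degree at most three.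
   Formalization: The nonnegative numbers $p_1,\dots,p_k$ and the guarantee γ are rational. -}

module Defs where

open import Data.Nat as ℕ using (ℕ; zero; suc; _≡ᵇ_)
open import Data.Bool using (Bool; true; false; if_then_else_; _∨_; _∧_; not)
open import Data.List using (List; []; _∷_; length; filter; _++_; [_])
open import Data.List.Membership.Propositional using (_∈_)
open import Data.List.Relation.Unary.Any using (Any)
open import Data.List.Relation.Unary.All using (All)
open import Data.List.Relation.Unary.AllPairs using (AllPairs)
open import Data.List.Relation.Unary.Unique.Propositional using (Unique)
open import Data.Vec using (Vec; []; _∷_; replicate)
open import Data.Integer using (+_)
open import Data.Rational using (ℚ; 0ℚ; 1ℚ; _/_; _≤_; _*_; _+_)
open import Data.Product using (_×_; _,_)
open import Data.Sum using (_⊎_)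
open import Data.Unit using (⊤)
open import Data.Empty using (⊥)
open import Relation.Nullary using (¬_)
open import Relation.Binary.PropositionalEquality using (_≡_; _≢_)

-- Vertices are natural numbers; an edge is a pair (u , v)
-- read as the unordered edge {u , v}.  A graph (equivalently, an
-- arrival sequence of its edges) is a list of edges; the i-th element
-- of the list is the i-th edge to arrive.

Edge : Set
Edge = ℕ × ℕ

incident : ℕ → Edge → Bool
incident w (u , v) = (w ≡ᵇ u) ∨ (w ≡ᵇ v)

sharesᵇ : Edge → Edge → Bool
sharesᵇ e (u , v) = incident u e ∨ incident v e

SameEdge : Edge → Edge → Set
SameEdge (u , v) (x , y) = ((u ≡ x) × (v ≡ y)) ⊎ ((u ≡ y) × (v ≡ x))

Simple : List Edge → Set
Simple G = All (λ e → Data.Product.proj₁ e ≢ Data.Product.proj₂ e) G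
         × AllPairs (λ e f → ¬ SameEdge e f) G

Adj : List Edge → ℕ → ℕ → Set
Adj G u v = Any (λ e → SameEdge e (u , v)) G

degree : List Edge → ℕ → ℕ
degree G w = length (filter (λ e → incident w e Data.Bool.≟ true) G)

MaxDegreeAtMost : ℕ → List Edge → Set
MaxDegreeAtMost d G = ∀ w → degree G w ℕ.≤ d

Walk : List Edge → List ℕ → Set
Walk G (u ∷ v ∷ vs) = Adj G u v × Walk G (v ∷ vs)
Walk G _ = ⊤

Cycle : List Edge → List ℕ → Set
Cycle G [] = ⊥
Cycle G (v ∷ vs) = (2 ℕ.≤ length vs) × Unique (v ∷ vs) × Walk G (v ∷ vs ++ [ v ])

Forest : List Edge → Set
Forest G = ∀ vs → ¬ Cycle G vs

Disjoint : Edge → Edge → Set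
Disjoint e f = sharesᵇ e f ≡ false

IsMatchingIn : List Edge → List Edge → Set
IsMatchingIn G M = All (_∈ G) M × AllPairs Disjoint M

IsMaximumMatching : List Edge → List Edge → Set
IsMaximumMatching G M =
  IsMatchingIn G M × (∀ M′ → IsMatchingIn G M′ → length M′ ℕ.≤ length M)

fits : Edge → List Edge → Bool
fits e [] = true
fits e (f ∷ M) = not (sharesᵇ e f) ∧ fits e M

insert : ∀ {k} → Edge → Vec (List Edge) k → Vec (List Edge) k
insert e [] = []
insert e (M ∷ Ms) = if fits e M then (e ∷ M) ∷ Ms else M ∷ insert e Ms

runFrom : ∀ {k} → Vec (List Edge) k → List Edge → Vec (List Edge) k
runFrom Ms [] = Ms
runFrom Ms (e ∷ es) = runFrom (insert e Ms) es

run : (k : ℕ) → List Edge → Vec (List Edge) k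
run k es = runFrom (replicate k []) es

expected : ∀ {k} → Vec ℚ k → Vec (List Edge) k → ℚ
expected [] [] = 0ℚ
expected (p ∷ ps) (M ∷ Ms) = p * ((+ length M) / 1) + expected ps Ms

sumℚ : ∀ {k} → Vec ℚ k → ℚ
sumℚ [] = 0ℚ
sumℚ (p ∷ ps) = p + sumℚ ps

IsDistribution : ∀ {k} → Vec ℚ k → Set
IsDistribution ps = Data.Vec.Relation.Unary.All.All (0ℚ ≤_) ps × sumℚ ps ≡ 1ℚ
  where import Data.Vec.Relation.Unary.All

-- MinIndex(k,p) achieves guarantee γ on forests of maximum degree three:
-- for every such forest G, every arrival order (G is a list, its order
-- is the arrival order) and every timepoint t (the first t edges have
-- arrived), Σ pᵢ|Mᵢ| ≥ γ · ν(arrived graph).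
AchievesGuarantee : (k : ℕ) → Vec ℚ k → ℚ → Set
AchievesGuarantee k ps γ =
  ∀ (G : List Edge) → Simple G → Forest G → MaxDegreeAtMost 3 G →
  ∀ (t : ℕ) (M : List Edge) → IsMaximumMatching (Data.List.take t G) M →
  γ * ((+ length M) / 1) ≤ expected ps (run k (Data.List.take t G))

-- The adversary strings together translated copies of one 17-edge forest (the period, on the
-- vertices 0 … 18), each glued by its vertex 0 to vertex 18 of the previous copy, after a first
-- edge (0 , 1).  Which matchings accept a new edge depends only on which of them cover its
-- endpoints, and at every glue vertex exactly the first matching does; so MinIndex treats every
-- copy in the same way, and each matching gains at most 5 edges per copy.  After n copies every
-- Mᵢ has at most 5n + 1 edges, while the graph has a matching of size 9n (and a vertex cover of
-- the same size), so the guarantee γ fails as soon as n exceeds the denominator of γ.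

module Submission where

open import Defs
open import Data.Nat using (ℕ)
open import Data.Vec using (Vec)
open import Data.Integer using (+_)
open import Data.Rational using (ℚ; _/_; _<_)
open import Relation.Nullary using (¬_)

open import Data.Bool as Bool using (true; false; if_then_else_; _∧_; _∨_; not; T)
open import Data.Bool.Properties using (∧-assoc; ∨-zeroʳ)
open import Data.Empty using (⊥-elim)
open import Data.Fin as Fin using (Fin; toℕ; fromℕ<)
import Data.Fin.Properties as Fin
open import Data.Integer as ℤ using (-[1+_])
import Data.Integer.Properties as ℤ
open import Data.List as List using (List; []; _∷_; _++_; [_]; length; filter)
import Data.List.Properties as List
open import Data.List.Membership.Propositional using (_∈_)
import Data.List.Membership.Propositional.Properties as Membership
import Data.List.Membership.DecPropositional as DecMembership
open import Data.List.Relation.Binary.Subset.Propositional using (_⊆_)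
import Data.List.Relation.Binary.Subset.Propositional.Properties as Subset
open import Data.List.Relation.Unary.All as All using (All; []; _∷_)
import Data.List.Relation.Unary.All.Properties as All
open import Data.List.Relation.Unary.AllPairs as AllPairs using (AllPairs; []; _∷_)
import Data.List.Relation.Unary.AllPairs.Properties as AllPairs
open import Data.List.Relation.Unary.Any as Any using (Any; here; there; _─_)
import Data.List.Relation.Unary.Any.Properties as Any
open import Data.List.Relation.Unary.Unique.Propositional using (Unique)
open import Data.Nat as ℕ using (zero; suc; _+_; _*_; _≤_; _≡ᵇ_; s≤s; z≤n)
import Data.Nat.Properties as ℕ
import Data.Nat.Coprimality as Coprime
open import Data.Nat.Solver using (module +-*-Solver)
import Data.Product as Product
open import Data.Product using (_×_; _,_; ∃; proj₁; proj₂)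
import Data.Product.Properties as Product
open import Data.Rational as ℚ using (mkℚ; toℚᵘ; 0ℚ; 1ℚ)
import Data.Rational.Properties as ℚ
import Data.Rational.Unnormalised as ℚᵘ
import Data.Rational.Unnormalised.Properties as ℚᵘ
open import Data.Sum as Sum using (_⊎_; inj₁; inj₂; [_,_]′)
open import Data.Unit using (⊤; tt)
open import Data.Vec as Vec using ([]; _∷_; replicate)
open import Data.Vec.Relation.Binary.Pointwise.Inductive using (Pointwise; []; _∷_)
open import Data.Vec.Relation.Unary.All as VecAll using ([]; _∷_)
import Data.Vec.Relation.Unary.All.Properties as VecAll
open import Function using (_∘_)
open import Relation.Binary.Definitions using (tri<; tri≈; tri>)
open import Relation.Binary.PropositionalEquality hiding ([_])
open import Relation.Nullary using (Dec; yes; no; ¬?)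
open import Relation.Nullary.Decidable using (from-yes; _×-dec_; _⊎-dec_)

open DecMembership ℕ._≟_ using (_∈?_)
open DecMembership (Product.≡-dec ℕ._≟_ ℕ._≟_) using () renaming (_∈?_ to _∈ₑ?_)

shift : ℕ → Edge → Edge
shift s (a , b) = (s + a , s + b)

shift-+ : ∀ s t e → shift (s + t) e ≡ shift s (shift t e)
shift-+ s t (a , b) = cong₂ _,_ (ℕ.+-assoc s t a) (ℕ.+-assoc s t b)

+-cancelˡ-≡ᵇ : ∀ s a b → (s + a ≡ᵇ s + b) ≡ (a ≡ᵇ b)
+-cancelˡ-≡ᵇ zero    a b = refl
+-cancelˡ-≡ᵇ (suc s) a b = +-cancelˡ-≡ᵇ s a b

incident-shift : ∀ s w e → incident (s + w) (shift s e) ≡ incident w e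
incident-shift s w (a , b) rewrite +-cancelˡ-≡ᵇ s w a | +-cancelˡ-≡ᵇ s w b = refl

sharesᵇ-shift : ∀ s e f → sharesᵇ (shift s e) (shift s f) ≡ sharesᵇ e f
sharesᵇ-shift s e (u , v) rewrite incident-shift s u e | incident-shift s v e = refl

fits-shift : ∀ s e M → fits (shift s e) (List.map (shift s) M) ≡ fits e M
fits-shift s e []      = refl
fits-shift s e (f ∷ M) rewrite sharesᵇ-shift s e f | fits-shift s e M = refl

fits-++ : ∀ e A B → fits e (A ++ B) ≡ fits e A ∧ fits e B
fits-++ e []      B = refl
fits-++ e (f ∷ A) B rewrite fits-++ e A B = sym (∧-assoc (not (sharesᵇ e f)) (fits e A) (fits e B))

-- MinIndex on top of a fixed background

Matchings : ℕ → Set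
Matchings k = Vec (List Edge) k

empty : ∀ k → Matchings k
empty k = replicate k []

runFrom-++ : ∀ {k} (Ms : Matchings k) A B → runFrom Ms (A ++ B) ≡ runFrom (runFrom Ms A) B
runFrom-++ Ms []      B = refl
runFrom-++ Ms (e ∷ A) B = runFrom-++ (insert e Ms) A B

infixr 5 _⊕_

_⊕_ : ∀ {k} → Matchings k → Matchings k → Matchings k
_⊕_ = Vec.zipWith _++_

empty-⊕ : ∀ {k} (Ms : Matchings k) → empty k ⊕ Ms ≡ Ms
empty-⊕ []       = refl
empty-⊕ (M ∷ Ms) = cong (M ∷_) (empty-⊕ Ms)

insertOver : ∀ {k} → Matchings k → Edge → Matchings k → Matchings k
insertOver []       e []       = []
insertOver (S ∷ Ss) e (D ∷ Ds) =
  if fits e D ∧ fits e S then (e ∷ D) ∷ Ds else D ∷ insertOver Ss e Ds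

runOver : ∀ {k} → Matchings k → Matchings k → List Edge → Matchings k
runOver S D []       = D
runOver S D (e ∷ es) = runOver S (insertOver S e D) es

insert-⊕ : ∀ {k} e (D S : Matchings k) → insert e (D ⊕ S) ≡ insertOver S e D ⊕ S
insert-⊕ e []       []       = refl
insert-⊕ e (D ∷ Ds) (S ∷ Ss) rewrite fits-++ e D S with fits e D ∧ fits e S
... | true  = refl
... | false = cong ((D ++ S) ∷_) (insert-⊕ e Ds Ss)

runFrom-⊕ : ∀ {k} (D S : Matchings k) es → runFrom (D ⊕ S) es ≡ runOver S D es ⊕ S
runFrom-⊕ D S []       = refl
runFrom-⊕ D S (e ∷ es) rewrite insert-⊕ e D S = runFrom-⊕ (insertOver S e D) S es

shiftAll : ∀ {k} → ℕ → Matchings k → Matchings k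
shiftAll s = Vec.map (List.map (shift s))

shiftAll-empty : ∀ s k → shiftAll s (empty k) ≡ empty k
shiftAll-empty s zero    = refl
shiftAll-empty s (suc k) = cong ([] ∷_) (shiftAll-empty s k)

FitsShifted : ∀ {k} → ℕ → Matchings k → Matchings k → Set
FitsShifted s S L = ∀ e → Pointwise (λ M l → fits (shift s e) M ≡ fits e l) S L

insertOver-shift : ∀ {k} s e {S L : Matchings k} →
  Pointwise (λ M l → fits (shift s e) M ≡ fits e l) S L →
  ∀ D → insertOver S (shift s e) (shiftAll s D) ≡ shiftAll s (insertOver L e D)
insertOver-shift s e []           []       = refl
insertOver-shift s e {L = l ∷ _} (S≈l ∷ Ss≈Ls) (D ∷ Ds) rewrite fits-shift s e D | S≈l
  with fits e D ∧ fits e l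
... | true  = refl
... | false = cong (List.map (shift s) D ∷_) (insertOver-shift s e Ss≈Ls Ds)

runOver-shift : ∀ {k} s {S L : Matchings k} → FitsShifted s S L →
  ∀ D es → runOver S (shiftAll s D) (List.map (shift s) es) ≡ shiftAll s (runOver L D es)
runOver-shift s S≈L D []       = refl
runOver-shift s {L = L} S≈L D (e ∷ es) rewrite insertOver-shift s e (S≈L e) D =
  runOver-shift s S≈L (insertOver L e D) es

runFrom-shift : ∀ {k} s {T L : Matchings k} → FitsShifted s T L → ∀ es →
  runFrom T (List.map (shift s) es) ≡ shiftAll s (runOver L (empty k) es) ⊕ T
runFrom-shift {k} s {T} {L} T≈L es = begin
  runFrom T es′                            ≡⟨ cong (λ X → runFrom X es′) (empty-⊕ T) ⟨
  runFrom (empty k ⊕ T) es′                ≡⟨ runFrom-⊕ (empty k) T es′ ⟩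
  runOver T (empty k) es′ ⊕ T              ≡⟨ cong (λ X → runOver T X es′ ⊕ T) (shiftAll-empty s k) ⟨
  runOver T (shiftAll s (empty k)) es′ ⊕ T ≡⟨ cong (_⊕ T) (runOver-shift s T≈L (empty k) es) ⟩
  shiftAll s (runOver L (empty k) es) ⊕ T  ∎
  where
  open ≡-Reasoning
  es′ = List.map (shift s) es

FitsShifted-empty : ∀ s k → FitsShifted s (empty k) (empty k)
FitsShifted-empty s zero    e = []
FitsShifted-empty s (suc k) e = refl ∷ FitsShifted-empty s k e

FitsShifted-⊕ : ∀ {k} s N {T Δ L : Matchings k} → FitsShifted s T L → FitsShifted N (Δ ⊕ L) L →
  FitsShifted (s + N) (shiftAll s Δ ⊕ T) L
FitsShifted-⊕ s N {T} {Δ} {L} T≈L ΔL≈L e = go (T≈L (shift N e)) (ΔL≈L e)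
  where
  go : ∀ {k} {T Δ L : Matchings k} →
       Pointwise (λ M l → fits (shift s (shift N e)) M ≡ fits (shift N e) l) T L →
       Pointwise (λ M l → fits (shift N e) M ≡ fits e l) (Δ ⊕ L) L →
       Pointwise (λ M l → fits (shift (s + N) e) M ≡ fits e l) (shiftAll s Δ ⊕ T) L
  go {T = []}    {[]}    {[]}    []             []               = []
  go {T = M ∷ _} {δ ∷ _} {l ∷ _} (M≈l ∷ Ms≈ls) (δl≈l ∷ δls≈ls) = step ∷ go Ms≈ls δls≈ls
    where
    open ≡-Reasoning
    step : fits (shift (s + N) e) (List.map (shift s) δ ++ M) ≡ fits e l
    step = begin
      fits (shift (s + N) e) (List.map (shift s) δ ++ M)
        ≡⟨ cong (λ x → fits x (List.map (shift s) δ ++ M)) (shift-+ s N e) ⟩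
      fits (shift s (shift N e)) (List.map (shift s) δ ++ M)
        ≡⟨ fits-++ _ (List.map (shift s) δ) M ⟩
      fits (shift s (shift N e)) (List.map (shift s) δ) ∧ fits (shift s (shift N e)) M
        ≡⟨ cong₂ _∧_ (fits-shift s (shift N e) δ) M≈l ⟩
      fits (shift N e) δ ∧ fits (shift N e) l
        ≡⟨ sym (fits-++ _ δ l) ⟩
      fits (shift N e) (δ ++ l)
        ≡⟨ δl≈l ⟩
      fits e l ∎

SizesAtMost : ∀ {k} → ℕ → Matchings k → Set
SizesAtMost c = VecAll.All (λ M → length M ≤ c)

SizesAtMost-shiftAll : ∀ {k} s {c} {D : Matchings k} → SizesAtMost c D → SizesAtMost c (shiftAll s D)
SizesAtMost-shiftAll s {c} = VecAll.map⁺ ∘ VecAll.map (λ {M} → subst (_≤ c) (sym (List.length-map (shift s) M)))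

SizesAtMost-⊕ : ∀ {k c d} {D S : Matchings k} → SizesAtMost c D → SizesAtMost d S → SizesAtMost (c + d) (D ⊕ S)
SizesAtMost-⊕ {D = []}    {[]}    []          []          = []
SizesAtMost-⊕ {D = δ ∷ _} {M ∷ _} (δ≤c ∷ D≤c) (M≤d ∷ S≤d) =
  ℕ.≤-trans (ℕ.≤-reflexive (List.length-++ δ)) (ℕ.+-mono-≤ δ≤c M≤d) ∷ SizesAtMost-⊕ D≤c S≤d

SizesAtMost-empty : ∀ c k → SizesAtMost c (empty k)
SizesAtMost-empty c zero    = []
SizesAtMost-empty c (suc k) = z≤n ∷ SizesAtMost-empty c k

infix 4 _≼_

data _≼_ {A : Set} : ∀ {m n} → Vec A m → Vec A n → Set where
  []  : ∀ {n} {ys : Vec A n} → [] ≼ ys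
  _∷_ : ∀ x {m n} {xs : Vec A m} {ys : Vec A n} → xs ≼ ys → x ∷ xs ≼ x ∷ ys

insert-≼ : ∀ {m n} e {Ms : Matchings m} {Ns : Matchings n} → Ms ≼ Ns → insert e Ms ≼ insert e Ns
insert-≼ e []           = []
insert-≼ e (M ∷ Ms≼Ns) with fits e M
... | true  = (e ∷ M) ∷ Ms≼Ns
... | false = M ∷ insert-≼ e Ms≼Ns

runFrom-≼ : ∀ {m n} {Ms : Matchings m} {Ns : Matchings n} → Ms ≼ Ns → ∀ es → runFrom Ms es ≼ runFrom Ns es
runFrom-≼ Ms≼Ns []       = Ms≼Ns
runFrom-≼ Ms≼Ns (e ∷ es) = runFrom-≼ (insert-≼ e Ms≼Ns) es

empty-≼ : ∀ {m n} → m ≤ n → empty m ≼ empty n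
empty-≼ z≤n       = []
empty-≼ (s≤s m≤n) = [] ∷ empty-≼ m≤n

run-≼ : ∀ {m n} → m ≤ n → ∀ es → run m es ≼ run n es
run-≼ m≤n = runFrom-≼ (empty-≼ m≤n)

SizesAtMost-≼ : ∀ {m n c} {Ms : Matchings m} {Ns : Matchings n} → Ms ≼ Ns → SizesAtMost c Ns → SizesAtMost c Ms
SizesAtMost-≼ []           _           = []
SizesAtMost-≼ (M ∷ Ms≼Ns) (M≤c ∷ Ns≤c) = M≤c ∷ SizesAtMost-≼ Ms≼Ns Ns≤c

ofℕ : ℕ → ℚ
ofℕ n = + n / 1

ofℕ≡mkℚ : ∀ n → ofℕ n ≡ mkℚ (+ n) 0 (Coprime.sym (Coprime.1-coprimeTo n))
ofℕ≡mkℚ n = ℚ.normalize-coprime (Coprime.sym (Coprime.1-coprimeTo n))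

ofℕ-mono-≤ : ∀ {m n} → m ≤ n → ofℕ m ℚ.≤ ofℕ n
ofℕ-mono-≤ {m} {n} m≤n rewrite ofℕ≡mkℚ m | ofℕ≡mkℚ n =
  ℚ.*≤* (subst₂ ℤ._≤_ (sym (ℤ.*-identityʳ (+ m))) (sym (ℤ.*-identityʳ (+ n))) (ℤ.+≤+ m≤n))

expected-≤ : ∀ {k c} (ps : Vec ℚ k) (Ms : Matchings k) → VecAll.All (0ℚ ℚ.≤_) ps →
  SizesAtMost c Ms → expected ps Ms ℚ.≤ sumℚ ps ℚ.* ofℕ c
expected-≤ {c = c} []       []       []         []          = ℚ.≤-reflexive (sym (ℚ.*-zeroˡ (ofℕ c)))
expected-≤ {c = c} (p ∷ ps) (M ∷ Ms) (0≤p ∷ 0≤ps) (M≤c ∷ Ms≤c) = begin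
  p ℚ.* ofℕ (length M) ℚ.+ expected ps Ms
    ≤⟨ ℚ.+-mono-≤ (ℚ.*-monoˡ-≤-nonNeg p {{ℚ.nonNegative 0≤p}} (ofℕ-mono-≤ M≤c))
                  (expected-≤ ps Ms 0≤ps Ms≤c) ⟩
  p ℚ.* ofℕ c ℚ.+ sumℚ ps ℚ.* ofℕ c
    ≡⟨ sym (ℚ.*-distribʳ-+ (ofℕ c) p (sumℚ ps)) ⟩
  (p ℚ.+ sumℚ ps) ℚ.* ofℕ c ∎
  where open ℚ.≤-Reasoning

-- Gluing graphs along a vertex: simplicity and degrees

AllVertices : (ℕ → Set) → List Edge → Set
AllVertices P = All (λ e → P (proj₁ e) × P (proj₂ e))

AllVertices-map : ∀ {P Q : ℕ → Set} → (∀ {x} → P x → Q x) → ∀ {G} → AllVertices P G → AllVertices Q G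
AllVertices-map P⇒Q = All.map (λ (Pa , Pb) → P⇒Q Pa , P⇒Q Pb)

AllVertices-shift : ∀ {P Q : ℕ → Set} s → (∀ {x} → P x → Q (s + x)) → ∀ {G} →
  AllVertices P G → AllVertices Q (List.map (shift s) G)
AllVertices-shift s P⇒Q = All.map⁺ ∘ All.map (λ (Pa , Pb) → P⇒Q Pa , P⇒Q Pb)

≢⇒≡ᵇ≡false : ∀ {m n} → m ≢ n → (m ≡ᵇ n) ≡ false
≢⇒≡ᵇ≡false {m} {n} m≢n with m ≡ᵇ n in eq
... | false = refl
... | true  = ⊥-elim (m≢n (ℕ.≡ᵇ⇒≡ m n (subst T (sym eq) _)))

≡ᵇ≡true⇒≡ : ∀ m n → (m ≡ᵇ n) ≡ true → m ≡ n
≡ᵇ≡true⇒≡ m n eq = ℕ.≡ᵇ⇒≡ m n (subst T (sym eq) _)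

incident-≢ : ∀ {w a b} → w ≢ a → w ≢ b → incident w (a , b) ≡ false
incident-≢ w≢a w≢b rewrite ≢⇒≡ᵇ≡false w≢a | ≢⇒≡ᵇ≡false w≢b = refl

AllVertices-≤⇒≢ : ∀ {s w} → s ℕ.< w → ∀ {G} → AllVertices (_≤ s) G → AllVertices (w ≢_) G
AllVertices-≤⇒≢ s<w = AllVertices-map (λ x≤s → ℕ.>⇒≢ (ℕ.≤-<-trans x≤s s<w))

<⇒≢+ : ∀ {w s} a → w ℕ.< s → w ≢ s + a
<⇒≢+ {s = s} a w<s = ℕ.<⇒≢ (ℕ.<-≤-trans w<s (ℕ.m≤m+n s a))

AllVertices-shift-≢ : ∀ {s w} → w ℕ.< s → ∀ G → AllVertices (w ≢_) (List.map (shift s) G)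
AllVertices-shift-≢ w<s G = All.map⁺ (All.tabulate (λ {(a , b)} _ → <⇒≢+ a w<s , <⇒≢+ b w<s))

m+n≤m⇒n≡0 : ∀ m {n} → m + n ≤ m → n ≡ 0
m+n≤m⇒n≡0 m {zero}  _        = refl
m+n≤m⇒n≡0 m {suc n} m+n≤m = ⊥-elim (ℕ.m+1+n≰m m m+n≤m)

¬SameEdge-shift : ∀ {s u v a b} → u ≤ s → v ≤ s → a ≢ b → ¬ SameEdge (u , v) (s + a , s + b)
¬SameEdge-shift {s} u≤s v≤s a≢b (inj₁ (refl , refl)) =
  a≢b (trans (m+n≤m⇒n≡0 s u≤s) (sym (m+n≤m⇒n≡0 s v≤s)))
¬SameEdge-shift {s} u≤s v≤s a≢b (inj₂ (refl , refl)) =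
  a≢b (trans (m+n≤m⇒n≡0 s v≤s) (sym (m+n≤m⇒n≡0 s u≤s)))

SameEdge-unshift : ∀ s e f → SameEdge (shift s e) (shift s f) → SameEdge e f
SameEdge-unshift s (a , b) (x , y) =
  Sum.map (Product.map (ℕ.+-cancelˡ-≡ s a x) (ℕ.+-cancelˡ-≡ s b y))
          (Product.map (ℕ.+-cancelˡ-≡ s a y) (ℕ.+-cancelˡ-≡ s b x))

Simple-++-shift : ∀ {s G P} → Simple G → Simple P → AllVertices (_≤ s) G → Simple (G ++ List.map (shift s) P)
Simple-++-shift {s} {G} {P} (loopsG , pairsG) (loopsP , pairsP) G≤s =
  All.++⁺ loopsG (All.map⁺ (All.map (λ a≢b → a≢b ∘ ℕ.+-cancelˡ-≡ s _ _) loopsP)) ,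
  AllPairs.++⁺ pairsG (AllPairs.map⁺ (AllPairs.map (λ {e f} ¬e~f → ¬e~f ∘ SameEdge-unshift s e f) pairsP)) cross
  where
  cross : All (λ e → All (λ f → ¬ SameEdge e f) (List.map (shift s) P)) G
  cross = All.map (λ (u≤s , v≤s) → All.map⁺ (All.map (¬SameEdge-shift u≤s v≤s) loopsP)) G≤s

degree-++ : ∀ A B w → degree (A ++ B) w ≡ degree A w + degree B w
degree-++ A B w = begin
  length (filter w∈? (A ++ B))          ≡⟨ cong length (List.filter-++ w∈? A B) ⟩
  length (filter w∈? A ++ filter w∈? B) ≡⟨ List.length-++ (filter w∈? A) ⟩
  degree A w + degree B w               ∎
  where
  open ≡-Reasoning
  w∈? : ∀ e → Dec (incident w e ≡ true)
  w∈? e = incident w e Bool.≟ true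

degree-shift : ∀ s w G → degree (List.map (shift s) G) (s + w) ≡ degree G w
degree-shift s w []      = refl
degree-shift s w (e ∷ G) rewrite incident-shift s w e with incident w e
... | true  = cong suc (degree-shift s w G)
... | false = degree-shift s w G

degree-shift-0 : ∀ s G → degree (List.map (shift s) G) s ≡ degree G 0
degree-shift-0 s G = subst (λ x → degree (List.map (shift s) G) x ≡ degree G 0) (ℕ.+-identityʳ s) (degree-shift s 0 G)

degree-≢ : ∀ {w G} → AllVertices (w ≢_) G → degree G w ≡ 0
degree-≢ []                   = refl
degree-≢ ((w≢a , w≢b) ∷ w∉G) rewrite incident-≢ w≢a w≢b = degree-≢ w∉G

MaxDegreeAtMost-++-shift : ∀ {d s G P} → MaxDegreeAtMost d G → MaxDegreeAtMost d P → AllVertices (_≤ s) G →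
  degree G s + degree P 0 ≤ d → MaxDegreeAtMost d (G ++ List.map (shift s) P)
MaxDegreeAtMost-++-shift {d} {s} {G} {P} G≤d P≤d G≤s glue≤d w
  rewrite degree-++ G (List.map (shift s) P) w with ℕ.<-cmp w s
... | tri< w<s _ _ rewrite degree-≢ (AllVertices-shift-≢ w<s P) = subst (_≤ d) (sym (ℕ.+-identityʳ _)) (G≤d w)
... | tri≈ _ refl _ rewrite degree-shift-0 s P = glue≤d
... | tri> _ _ s<w rewrite degree-≢ (AllVertices-≤⇒≢ s<w G≤s) =
  subst (λ x → degree (List.map (shift s) P) x ≤ d) (ℕ.m+[n∸m]≡n (ℕ.<⇒≤ s<w))
        (subst (_≤ d) (sym (degree-shift s (w ℕ.∸ s) P)) (P≤d (w ℕ.∸ s)))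

Covers : List ℕ → Edge → Set
Covers C e = Any (λ c → incident c e ≡ true) C

Covers-shift : ∀ s {C} e → Covers C e → Covers (List.map (_+_ s) C) (shift s e)
Covers-shift s e C∋e = Any.map⁺ (Any.map (λ {c} c∈e → trans (incident-shift s c e) c∈e) C∋e)

Disjoint-shift : ∀ {s u v} e → u ℕ.< s → v ℕ.< s → Disjoint (shift s e) (u , v)
Disjoint-shift (a , b) u<s v<s
  rewrite incident-≢ (<⇒≢+ a u<s) (<⇒≢+ b u<s) | incident-≢ (<⇒≢+ a v<s) (<⇒≢+ b v<s) = refl

sharesᵇ-common : ∀ c e f → incident c e ≡ true → incident c f ≡ true → sharesᵇ e f ≡ true
sharesᵇ-common c e (u , v) c∈e c∈f with c ≡ᵇ u in c≡ᵇu
... | true  = cong (_∨ incident v e) (subst (λ x → incident x e ≡ true) (≡ᵇ≡true⇒≡ c u c≡ᵇu) c∈e)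
... | false = trans (cong (incident u e ∨_) v∈e) (∨-zeroʳ (incident u e))
  where v∈e = subst (λ x → incident x e ≡ true) (≡ᵇ≡true⇒≡ c v c∈f) c∈e

Covers-─ : ∀ {C e f} → Disjoint e f → (c∈e : Covers C e) → Covers C f → Covers (C ─ c∈e) f
Covers-─ {c ∷ _} {e} {f} e#f (here c∈e) (here c∈f) with () ← trans (sym e#f) (sharesᵇ-common c e f c∈e c∈f)
Covers-─ e#f (here _)    (there C∋f) = C∋f
Covers-─ e#f (there _)   (here c∈f)  = here c∈f
Covers-─ e#f (there C∋e) (there C∋f) = there (Covers-─ e#f C∋e C∋f)

length≤cover : ∀ {C M} → AllPairs Disjoint M → All (Covers C) M → length M ≤ length C
length≤cover {C} {[]}    _              _              = z≤n
length≤cover {C} {e ∷ M} (e#M ∷ M-match) (C∋e ∷ C∋M) = begin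
  suc (length M)         ≤⟨ s≤s (length≤cover M-match C∖c∋M) ⟩
  suc (length (C ─ C∋e)) ≡⟨ List.length-removeAt′ C (Any.index C∋e) ⟨
  length C               ∎
  where
  open ℕ.≤-Reasoning
  C∖c∋M : All (Covers (C ─ C∋e)) M
  C∖c∋M = All.zipWith (λ (e#f , C∋f) → Covers-─ {C} e#f C∋e C∋f) (e#M , C∋M)

-- Forests

Adj-sym : ∀ {G a b} → Adj G a b → Adj G b a
Adj-sym = Any.map Sum.swap

Walk-mono : ∀ {G H} → (∀ {a b} → Adj G a b → Adj H a b) → ∀ W → Walk G W → Walk H W
Walk-mono G⇒H (a ∷ b ∷ W) (a~b , walk) = G⇒H a~b , Walk-mono G⇒H (b ∷ W) walk
Walk-mono G⇒H (a ∷ [])    _            = _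
Walk-mono G⇒H []          _            = _

Cycle-mono : ∀ {G H} → (∀ {a b} → Adj G a b → Adj H a b) → ∀ {vs} → Cycle G vs → Cycle H vs
Cycle-mono G⇒H {v ∷ vs} (len , uniq , walk) = len , uniq , Walk-mono G⇒H (v ∷ vs ++ [ v ]) walk

Forest-⊆ : ∀ {G H} → G ⊆ H → Forest H → Forest G
Forest-⊆ G⊆H forestH vs = forestH vs ∘ Cycle-mono (Subset.Any-resp-⊆ G⊆H)

Forest-[] : Forest []
Forest-[] (v ∷ [])         (() , _)
Forest-[] (v ∷ w ∷ vs)     (_ , _ , () , _)

Walk-snoc : ∀ {G} xs {a b} → Walk G (xs ++ [ a ]) → Adj G a b → Walk G ((xs ++ [ a ]) ++ [ b ])
Walk-snoc []           _              a~b = a~b , _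
Walk-snoc (y ∷ [])     (y~a , _)      a~b = y~a , a~b , _
Walk-snoc (y ∷ z ∷ zs) (y~z , walk)   a~b = y~z , Walk-snoc (z ∷ zs) walk a~b

Unique-rotate : ∀ {a : ℕ} xs → Unique (a ∷ xs) → Unique (xs ++ [ a ])
Unique-rotate xs (a∉xs ∷ uniq) = AllPairs.++⁺ uniq ([] ∷ []) (All.map (λ a≢x → (a≢x ∘ sym) ∷ []) a∉xs)

Cycle-rotate : ∀ {G} a ys → Cycle G (a ∷ ys) → Cycle G (ys ++ [ a ])
Cycle-rotate a (b ∷ cs) (s≤s len , uniq , a~b , walk) =
  subst (2 ≤_) (sym (List.length-++ cs)) (ℕ.+-monoˡ-≤ 1 len) ,
  Unique-rotate (b ∷ cs) uniq ,
  Walk-snoc (b ∷ cs) walk a~b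

Cycle-rotateTo : ∀ {G} pre x post → Cycle G (pre ++ x ∷ post) → Cycle G (x ∷ post ++ pre)
Cycle-rotateTo {G} []        x post cycle = subst (λ l → Cycle G (x ∷ l)) (sym (List.++-identityʳ post)) cycle
Cycle-rotateTo {G} (a ∷ pre) x post cycle =
  subst (λ l → Cycle G (x ∷ l)) (List.++-assoc post [ a ] pre)
    (Cycle-rotateTo pre x (post ++ [ a ])
      (subst (Cycle G) (List.++-assoc pre (x ∷ post) [ a ]) (Cycle-rotate a (pre ++ x ∷ post) cycle)))

Walk-last : ∀ {G x} a r rs → Walk G (a ∷ (r ∷ rs) ++ [ x ]) → ∃ λ y → y ∈ r ∷ rs × Adj G y x
Walk-last a r []        (_ , r~x , _) = r , here refl , r~x
Walk-last a r (r′ ∷ rs) (_ , walk)    with y , y∈ , y~x ← Walk-last r r′ rs walk = y , there y∈ , y~x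

≢⇒¬SameEdge : ∀ {x a p q} → x ≢ p → x ≢ q → ¬ SameEdge (p , q) (a , x)
≢⇒¬SameEdge x≢p x≢q (inj₁ (_ , q≡x)) = x≢q (sym q≡x)
≢⇒¬SameEdge x≢p x≢q (inj₂ (p≡x , _)) = x≢p (sym p≡x)

SameEdge-leaf : ∀ {e u x a} → u ≢ x → SameEdge e (u , x) → SameEdge e (a , x) → a ≡ u
SameEdge-leaf u≢x (inj₁ (refl , refl)) (inj₁ (refl , _)) = refl
SameEdge-leaf u≢x (inj₁ (refl , refl)) (inj₂ (refl , _)) = ⊥-elim (u≢x refl)
SameEdge-leaf u≢x (inj₂ (refl , refl)) (inj₁ (_ , refl)) = ⊥-elim (u≢x refl)
SameEdge-leaf u≢x (inj₂ (refl , refl)) (inj₂ (_ , refl)) = refl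

SameEdge-endpoint : ∀ {e u x a b} → SameEdge e (u , x) → SameEdge e (a , b) → x ≡ a ⊎ x ≡ b
SameEdge-endpoint (inj₁ (refl , refl)) (inj₁ (_ , refl)) = inj₂ refl
SameEdge-endpoint (inj₁ (refl , refl)) (inj₂ (_ , refl)) = inj₁ refl
SameEdge-endpoint (inj₂ (refl , refl)) (inj₁ (refl , _)) = inj₁ refl
SameEdge-endpoint (inj₂ (refl , refl)) (inj₂ (refl , _)) = inj₂ refl

module _ {H e u x} (x∉H : AllVertices (x ≢_) H) (u≢x : u ≢ x) (e~ux : SameEdge e (u , x)) where

  Adj-leaf : ∀ {a} → Adj (e ∷ H) a x → a ≡ u
  Adj-leaf (here e~ax)  = SameEdge-leaf u≢x e~ux e~ax
  Adj-leaf (there H∋ax) =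
    ⊥-elim (All.All¬⇒¬Any (All.map (λ (x≢p , x≢q) → ≢⇒¬SameEdge x≢p x≢q) x∉H) H∋ax)

  Adj-avoiding : ∀ {a b} → x ≢ a → x ≢ b → Adj (e ∷ H) a b → Adj H a b
  Adj-avoiding x≢a x≢b (here e~ab)  = ⊥-elim (Sum.[ x≢a , x≢b ] (SameEdge-endpoint e~ux e~ab))
  Adj-avoiding x≢a x≢b (there H∋ab) = H∋ab

  Walk-avoiding : ∀ W → All (x ≢_) W → Walk (e ∷ H) W → Walk H W
  Walk-avoiding (a ∷ b ∷ W) (x≢a ∷ x≢b ∷ x∉W) (a~b , walk) =
    Adj-avoiding x≢a x≢b a~b , Walk-avoiding (b ∷ W) (x≢b ∷ x∉W) walk
  Walk-avoiding (a ∷ [])    _                   _            = _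
  Walk-avoiding []          _                   _            = _

  -- Both cycle-neighbours of the leaf x would have to be u.
  ¬Cycle-through-leaf : ∀ {vs} → ¬ Cycle (e ∷ H) (x ∷ vs)
  ¬Cycle-through-leaf {_ ∷ []}     (s≤s () , _)
  ¬Cycle-through-leaf {y ∷ r ∷ rs} (_ , (_ ∷ y∉rrs ∷ _) , x~y , walk)
    with z , z∈rrs , z~x ← Walk-last y r rs walk
    = All.lookup y∉rrs z∈rrs (trans (Adj-leaf (Adj-sym x~y)) (sym (Adj-leaf z~x)))

  Forest-∷ : Forest H → Forest (e ∷ H)
  Forest-∷ forestH (v ∷ vs) cycle@(len , uniq , walk) with x ∈? v ∷ vs
  ... | no  x∉cycle =
    forestH (v ∷ vs) (len , uniq , Walk-avoiding (v ∷ vs ++ [ v ]) (All.++⁺ x≢vvs (All.head x≢vvs ∷ [])) walk)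
    where
    x≢vvs : All (x ≢_) (v ∷ vs)
    x≢vvs = All.¬Any⇒All¬ (v ∷ vs) x∉cycle
  ... | yes x∈cycle with pre , post , vvs≡ ← Membership.∈-∃++ x∈cycle
    = ¬Cycle-through-leaf (Cycle-rotateTo pre x post (subst (Cycle (e ∷ H)) vvs≡ cycle))

AllVertices-≢? : ∀ x G → Dec (AllVertices (x ≢_) G)
AllVertices-≢? x = All.all? (λ (a , b) → ¬? (x ℕ.≟ a) ×-dec ¬? (x ℕ.≟ b))

NewLeaf : ℕ → List Edge → Set
NewLeaf x R = x ≢ 0 × AllVertices (x ≢_) R

-- Read backwards, the list grows a forest leaf by leaf, never attaching a leaf at the glue vertex 0.
LeafOrdered : List Edge → Set
LeafOrdered []            = ⊤
LeafOrdered ((a , b) ∷ R) = a ≢ b × (NewLeaf b R ⊎ NewLeaf a R) × LeafOrdered R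

leafOrdered? : ∀ Q → Dec (LeafOrdered Q)
leafOrdered? []            = yes tt
leafOrdered? ((a , b) ∷ R) = ¬? (a ℕ.≟ b) ×-dec (newLeaf? b ⊎-dec newLeaf? a) ×-dec leafOrdered? R
  where
  newLeaf? : ∀ x → Dec (NewLeaf x R)
  newLeaf? x = ¬? (x ℕ.≟ 0) ×-dec AllVertices-≢? x R

NewLeaf-shift : ∀ {s x R H} → NewLeaf x R → AllVertices (_≤ s) H →
  AllVertices (s + x ≢_) (List.map (shift s) R ++ H)
NewLeaf-shift {s} {x} (x≢0 , x∉R) H≤s =
  All.++⁺ (AllVertices-shift s (λ x≢y → x≢y ∘ ℕ.+-cancelˡ-≡ s x _) x∉R)
          (AllVertices-≤⇒≢ (ℕ.m<m+n s (ℕ.n≢0⇒n>0 x≢0)) H≤s)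

Forest-++-shift : ∀ {s H} → Forest H → AllVertices (_≤ s) H →
  ∀ Q → LeafOrdered Q → Forest (List.map (shift s) Q ++ H)
Forest-++-shift forestH H≤s [] _ = forestH
Forest-++-shift {s} forestH H≤s ((a , b) ∷ R) (a≢b , inj₁ b-leaf , ordR) =
  Forest-∷ (NewLeaf-shift b-leaf H≤s) (a≢b ∘ ℕ.+-cancelˡ-≡ s a b) (inj₁ (refl , refl))
    (Forest-++-shift forestH H≤s R ordR)
Forest-++-shift {s} forestH H≤s ((a , b) ∷ R) (a≢b , inj₂ a-leaf , ordR) =
  Forest-∷ (NewLeaf-shift a-leaf H≤s) (a≢b ∘ sym ∘ ℕ.+-cancelˡ-≡ s b a) (inj₂ (refl , refl))
    (Forest-++-shift forestH H≤s R ordR)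

-- The adversary and the run of MinIndex on it

period : List Edge
period = (0 , 13) ∷ (0 , 15) ∷ (1 , 2) ∷ (3 , 18) ∷ (4 , 3) ∷ (5 , 6) ∷ (7 , 1) ∷ (8 , 9) ∷ (8 , 7)
       ∷ (1 , 10) ∷ (3 , 11) ∷ (9 , 12) ∷ (4 , 8) ∷ (2 , 13) ∷ (7 , 5) ∷ (6 , 14) ∷ (16 , 17) ∷ []

-- The state as seen from a glue vertex, relabelled 0: only the first matching covers it, here
-- through the loop (0 , 0).  A period only uses the first four matchings; any k more may follow.
glued : ∀ k → Matchings (4 + k)
glued k = ((0 , 0) ∷ []) ∷ [] ∷ [] ∷ [] ∷ empty k

gain : ∀ k → Matchings (4 + k)
gain k = runOver (glued k) (empty (4 + k)) period

-- After a period the new glue vertex 18 is again covered by the first matching only.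
gain-fitsShifted : ∀ k → FitsShifted 18 (gain k ⊕ glued k) (glued k)
gain-fitsShifted k (zero  , zero)  rewrite empty-⊕ (empty k) =
  refl ∷ refl ∷ refl ∷ refl ∷ FitsShifted-empty 18 k _
gain-fitsShifted k (zero  , suc b) rewrite empty-⊕ (empty k) =
  refl ∷ refl ∷ refl ∷ refl ∷ FitsShifted-empty 18 k _
gain-fitsShifted k (suc a , zero)  rewrite empty-⊕ (empty k) =
  refl ∷ refl ∷ refl ∷ refl ∷ FitsShifted-empty 18 k _
gain-fitsShifted k (suc a , suc b) rewrite empty-⊕ (empty k) =
  refl ∷ refl ∷ refl ∷ refl ∷ FitsShifted-empty 18 k _

gain-sizes : ∀ k → SizesAtMost 5 (gain k)
gain-sizes k = ℕ.≤-refl ∷ ℕ.≤-refl ∷ ℕ.≤-refl ∷ ℕ.m≤m+n 2 3 ∷ SizesAtMost-empty 5 k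

offset : ℕ → ℕ
offset zero    = 1
offset (suc n) = offset n + 18

periods : ℕ → List Edge
periods zero    = []
periods (suc n) = periods n ++ List.map (shift (offset n)) period

adversary : ℕ → List Edge
adversary n = (0 , 1) ∷ periods n

run-adversary-suc : ∀ k n → FitsShifted (offset n) (run (4 + k) (adversary n)) (glued k) →
  run (4 + k) (adversary (suc n)) ≡ shiftAll (offset n) (gain k) ⊕ run (4 + k) (adversary n)
run-adversary-suc k n ≈glued =
  trans (runFrom-++ (insert (0 , 1) (empty (4 + k))) (periods n) (List.map (shift (offset n)) period))
        (runFrom-shift (offset n) ≈glued period)

run-adversary-fitsShifted : ∀ k n → FitsShifted (offset n) (run (4 + k) (adversary n)) (glued k)
run-adversary-fitsShifted k zero (zero  , zero)  = refl ∷ refl ∷ refl ∷ refl ∷ FitsShifted-empty 1 k _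
run-adversary-fitsShifted k zero (zero  , suc b) = refl ∷ refl ∷ refl ∷ refl ∷ FitsShifted-empty 1 k _
run-adversary-fitsShifted k zero (suc a , zero)  = refl ∷ refl ∷ refl ∷ refl ∷ FitsShifted-empty 1 k _
run-adversary-fitsShifted k zero (suc a , suc b) = refl ∷ refl ∷ refl ∷ refl ∷ FitsShifted-empty 1 k _
run-adversary-fitsShifted k (suc n) rewrite run-adversary-suc k n (run-adversary-fitsShifted k n) =
  FitsShifted-⊕ (offset n) 18 (run-adversary-fitsShifted k n) (gain-fitsShifted k)

run-adversary-sizes : ∀ k n → SizesAtMost (1 + n * 5) (run (4 + k) (adversary n))
run-adversary-sizes k zero = ℕ.≤-refl ∷ z≤n ∷ z≤n ∷ z≤n ∷ SizesAtMost-empty 1 k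
run-adversary-sizes k (suc n) rewrite run-adversary-suc k n (run-adversary-fitsShifted k n) =
  SizesAtMost-⊕ (SizesAtMost-shiftAll (offset n) (gain-sizes k)) (run-adversary-sizes k n)

period-vertices : AllVertices (_≤ 18) period
period-vertices = from-yes (All.all? (λ (a , b) → (a ℕ.≤? 18) ×-dec (b ℕ.≤? 18)) period)

period-simple : Simple period
period-simple = from-yes (All.all? (λ (a , b) → ¬? (a ℕ.≟ b)) period)
              , from-yes (AllPairs.allPairs? (λ e f → ¬? (sameEdge? e f)) period)
  where
  sameEdge? : ∀ e f → Dec (SameEdge e f)
  sameEdge? (u , v) (x , y) = ((u ℕ.≟ x) ×-dec (v ℕ.≟ y)) ⊎-dec ((u ℕ.≟ y) ×-dec (v ℕ.≟ x))

period-maxDegree : MaxDegreeAtMost 3 period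
period-maxDegree w with w ℕ.<? 19
... | yes w<19 = subst (λ x → degree period x ≤ 3) (Fin.toℕ-fromℕ< w<19) (upTo18 (fromℕ< w<19))
  where
  upTo18 : ∀ (i : Fin 19) → degree period (toℕ i) ≤ 3
  upTo18 = from-yes (Fin.all? {n = 19} (λ i → degree period (toℕ i) ℕ.≤? 3))
... | no  w≮19 rewrite degree-≢ (AllVertices-≤⇒≢ (ℕ.≮⇒≥ w≮19) period-vertices) = z≤n

adversary-vertices : ∀ n → AllVertices (_≤ offset n) (adversary n)
adversary-vertices zero    = (z≤n , s≤s z≤n) ∷ []
adversary-vertices (suc n) =
  All.++⁺ (AllVertices-map (λ x≤s → ℕ.≤-trans x≤s (ℕ.m≤m+n (offset n) 18)) (adversary-vertices n))
          (AllVertices-shift (offset n) (ℕ.+-monoʳ-≤ (offset n)) period-vertices)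

adversary-simple : ∀ n → Simple (adversary n)
adversary-simple zero    = ((λ ()) ∷ []) , ([] ∷ [])
adversary-simple (suc n) = Simple-++-shift (adversary-simple n) period-simple (adversary-vertices n)

adversary-glue-degree : ∀ n → degree (adversary n) (offset n) ≤ 1
adversary-glue-degree zero    = s≤s z≤n
adversary-glue-degree (suc n) = ℕ.≤-reflexive (begin
  degree (adversary n ++ P) (offset n + 18)
    ≡⟨ degree-++ (adversary n) P (offset n + 18) ⟩
  degree (adversary n) (offset n + 18) + degree P (offset n + 18)
    ≡⟨ cong₂ _+_ old-part (degree-shift (offset n) 18 period) ⟩
  degree period 18 ∎)
  where
  open ≡-Reasoning
  P : List Edge
  P = List.map (shift (offset n)) period
  old-part : degree (adversary n) (offset n + 18) ≡ 0
  old-part = degree-≢ (AllVertices-≤⇒≢ (ℕ.m<m+n (offset n) (s≤s z≤n)) (adversary-vertices n))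

adversary-maxDegree : ∀ n → MaxDegreeAtMost 3 (adversary n)
adversary-maxDegree zero    w =
  ℕ.≤-trans (List.length-filter (λ e → incident w e Bool.≟ true) ((0 , 1) ∷ [])) (s≤s z≤n)
adversary-maxDegree (suc n)   =
  MaxDegreeAtMost-++-shift (adversary-maxDegree n) period-maxDegree (adversary-vertices n)
                           (ℕ.+-monoˡ-≤ 2 (adversary-glue-degree n))

periodByLeaves : List Edge
periodByLeaves = (16 , 17) ∷ (3 , 11) ∷ (3 , 18) ∷ (6 , 14) ∷ (4 , 3) ∷ (9 , 12) ∷ (5 , 6) ∷ (4 , 8)
               ∷ (8 , 9) ∷ (7 , 5) ∷ (8 , 7) ∷ (1 , 10) ∷ (7 , 1) ∷ (1 , 2) ∷ (2 , 13) ∷ (0 , 15) ∷ (0 , 13) ∷ []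

period⊆periodByLeaves : period ⊆ periodByLeaves
period⊆periodByLeaves = All.lookup (from-yes (All.all? (_∈ₑ? periodByLeaves) period))

adversary-forest : ∀ n → Forest (adversary n)
adversary-forest zero    = Forest-∷ {x = 1} [] (λ ()) (inj₁ (refl , refl)) Forest-[]
adversary-forest (suc n) =
  Forest-⊆ reorder (Forest-++-shift (adversary-forest n) (adversary-vertices n) periodByLeaves
                                    (from-yes (leafOrdered? periodByLeaves)))
  where
  s : ℕ
  s = offset n
  reorder : adversary n ++ List.map (shift s) period ⊆ List.map (shift s) periodByLeaves ++ adversary n
  reorder e∈ = [ Membership.∈-++⁺ʳ (List.map (shift s) periodByLeaves)
               , Membership.∈-++⁺ˡ ∘ Subset.map⁺ (shift s) period⊆periodByLeaves
               ]′ (Membership.∈-++⁻ (adversary n) e∈)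

periodMatching : List Edge
periodMatching = (0 , 15) ∷ (1 , 10) ∷ (3 , 11) ∷ (9 , 12) ∷ (4 , 8) ∷ (2 , 13) ∷ (7 , 5) ∷ (6 , 14)
               ∷ (16 , 17) ∷ []

periodCover : List ℕ
periodCover = 0 ∷ 1 ∷ 2 ∷ 3 ∷ 4 ∷ 6 ∷ 7 ∷ 9 ∷ 16 ∷ []

periodMatching⊆period : All (_∈ period) periodMatching
periodMatching⊆period = from-yes (All.all? (_∈ₑ? period) periodMatching)

periodMatching-vertices : AllVertices (ℕ._< 18) periodMatching
periodMatching-vertices = from-yes (All.all? (λ (a , b) → (a ℕ.<? 18) ×-dec (b ℕ.<? 18)) periodMatching)

periodMatching-disjoint : AllPairs Disjoint periodMatching
periodMatching-disjoint = from-yes (AllPairs.allPairs? (λ e f → sharesᵇ e f Bool.≟ false) periodMatching)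

period-covered : All (Covers periodCover) period
period-covered = from-yes (All.all? (λ e → Any.any? (λ c → incident c e Bool.≟ true) periodCover) period)

matching : ℕ → List Edge
matching zero    = []
matching (suc n) = List.map (shift (offset n)) periodMatching ++ matching n

cover : ℕ → List ℕ
cover zero    = []
cover (suc n) = List.map (_+_ (offset n)) periodCover ++ cover n

length-matching : ∀ n → length (matching n) ≡ n * 9
length-matching zero    = refl
length-matching (suc n) = trans (List.length-++ (List.map (shift (offset n)) periodMatching) {matching n})
                                (cong₂ _+_ (List.length-map (shift (offset n)) periodMatching) (length-matching n))

length-cover : ∀ n → length (cover n) ≡ n * 9
length-cover zero    = refl
length-cover (suc n) = trans (List.length-++ (List.map (_+_ (offset n)) periodCover) {cover n})
                             (cong₂ _+_ (List.length-map (_+_ (offset n)) periodCover) (length-cover n))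

matching-vertices : ∀ n → AllVertices (ℕ._< offset n) (matching n)
matching-vertices zero    = []
matching-vertices (suc n) =
  All.++⁺ (AllVertices-shift (offset n) (ℕ.+-monoʳ-< (offset n)) periodMatching-vertices)
          (AllVertices-map (λ x<s → ℕ.<-≤-trans x<s (ℕ.m≤m+n (offset n) 18)) (matching-vertices n))

matching-⊆ : ∀ n → All (_∈ adversary n) (matching n)
matching-⊆ zero    = []
matching-⊆ (suc n) =
  All.++⁺ (All.map⁺ {f = shift s} (All.map (Membership.∈-++⁺ʳ (adversary n) ∘ Membership.∈-map⁺ (shift s))
                                           periodMatching⊆period))
          (All.map Membership.∈-++⁺ˡ (matching-⊆ n))
  where
  s : ℕ
  s = offset n

matching-disjoint : ∀ n → AllPairs Disjoint (matching n)
matching-disjoint zero    = []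
matching-disjoint (suc n) =
  AllPairs.++⁺ (AllPairs.map⁺ {f = shift s} (AllPairs.map (λ {e f} → trans (sharesᵇ-shift s e f)) periodMatching-disjoint))
               (matching-disjoint n)
               (All.map⁺ {f = shift s} (All.tabulate (λ {e} _ → All.map (λ (u<s , v<s) → Disjoint-shift e u<s v<s)
                                                                        (matching-vertices n))))
  where
  s : ℕ
  s = offset n

periods-covered : ∀ n → All (Covers (cover n)) (periods n)
periods-covered zero    = []
periods-covered (suc n) =
  All.++⁺ (All.map (Any.++⁺ʳ (List.map (_+_ (offset n)) periodCover)) (periods-covered n))
          (All.map⁺ {f = shift (offset n)} (All.map (λ {e} → Any.++⁺ˡ ∘ Covers-shift (offset n) e) period-covered))

first-edge-covered : ∀ n → Covers (cover (suc n)) (0 , 1)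
first-edge-covered zero    = here refl
first-edge-covered (suc n) = Any.++⁺ʳ (List.map (_+_ (offset (suc n))) periodCover) (first-edge-covered n)

adversary-maximumMatching : ∀ n → IsMaximumMatching (adversary (suc n)) (matching (suc n))
adversary-maximumMatching n = (matching-⊆ (suc n) , matching-disjoint (suc n)) , maximum
  where
  open ℕ.≤-Reasoning
  covered : All (Covers (cover (suc n))) (adversary (suc n))
  covered = first-edge-covered n ∷ periods-covered (suc n)
  maximum : ∀ M → IsMatchingIn (adversary (suc n)) M → length M ≤ length (matching (suc n))
  maximum M (M⊆G , M-disjoint) = begin
    length M                  ≤⟨ length≤cover M-disjoint (All.map (All.lookup covered) M⊆G) ⟩
    length (cover (suc n))    ≡⟨ length-cover (suc n) ⟩
    suc n * 9                 ≡⟨ length-matching (suc n) ⟨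
    length (matching (suc n)) ∎

m≤denominator : ∀ a D m → 5 * D ℕ.< a * 9 → a * (m * 9) ≤ (1 + m * 5) * D → m ≤ D
m≤denominator a D m 5D<9a a9m≤[1+5m]D = ℕ.+-cancelˡ-≤ (m * (5 * D)) m D (begin
  m * (5 * D) + m   ≡⟨ solve 2 (λ m D → m :* (con 5 :* D) :+ m := m :* (con 1 :+ con 5 :* D)) refl m D ⟩
  m * (1 + 5 * D)   ≤⟨ ℕ.*-monoʳ-≤ m 5D<9a ⟩
  m * (a * 9)       ≡⟨ solve 2 (λ m a → m :* (a :* con 9) := a :* (m :* con 9)) refl m a ⟩
  a * (m * 9)       ≤⟨ a9m≤[1+5m]D ⟩
  (1 + m * 5) * D   ≡⟨ solve 2 (λ m D → (con 1 :+ m :* con 5) :* D := m :* (con 5 :* D) :+ D) refl m D ⟩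
  m * (5 * D) + D   ∎)
  where
  open ℕ.≤-Reasoning
  open +-*-Solver

toℚᵘ-ofℕ : ∀ n → toℚᵘ (ofℕ n) ≡ ℚᵘ.mkℚᵘ (+ n) 0
toℚᵘ-ofℕ n = cong toℚᵘ (ofℕ≡mkℚ n)

ℚ-bound⇒≤denominator : ∀ γ m → (+ 5) / 9 < γ →
  γ ℚ.* ofℕ (m * 9) ℚ.≤ ofℕ (1 + m * 5) → m ≤ ℚ.↧ₙ γ
ℚ-bound⇒≤denominator (mkℚ -[1+ a ] d _) m (ℚ.*<* ()) _
ℚ-bound⇒≤denominator γ@(mkℚ (+ a) d _) m 5/9<γ γ9m≤1+5m with ℚ.toℚᵘ-mono-< 5/9<γ | bound
  where
  bound : ℚᵘ.mkℚᵘ (+ a) d ℚᵘ.* ℚᵘ.mkℚᵘ (+ (m * 9)) 0 ℚᵘ.≤ ℚᵘ.mkℚᵘ (+ (1 + m * 5)) 0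
  bound = subst₂ ℚᵘ._≤_ (cong (ℚᵘ.mkℚᵘ (+ a) d ℚᵘ.*_) (toℚᵘ-ofℕ (m * 9)))
                        (toℚᵘ-ofℕ (1 + m * 5))
            (ℚᵘ.≤-respˡ-≃ (ℚ.toℚᵘ-homo-* γ (ofℕ (m * 9))) (ℚ.toℚᵘ-mono-≤ γ9m≤1+5m))
... | ℚᵘ.*<* 5D<9a | ℚᵘ.*≤* a9m≤[1+5m]D = m≤denominator a (suc d) m
  (ℤ.drop‿+<+ (subst₂ ℤ._<_ (sym (ℤ.pos-* 5 (suc d))) (sym (ℤ.pos-* a 9)) 5D<9a))
  (ℤ.drop‿+≤+ (subst₂ ℤ._≤_ (trans (ℤ.*-identityʳ _) (sym (ℤ.pos-* a (m * 9))))
                             (trans (sym (ℤ.pos-* (1 + m * 5) (suc (d * 1)))) (cong (λ x → + ((1 + m * 5) * suc x)) (ℕ.*-identityʳ d)))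
                             a9m≤[1+5m]D))

expected-adversary-≤ : ∀ {k} (ps : Vec ℚ k) → IsDistribution ps → ∀ n →
  expected ps (run k (adversary n)) ℚ.≤ ofℕ (1 + n * 5)
expected-adversary-≤ {k} ps (0≤ps , Σps≡1) n = begin
  expected ps (run k (adversary n))  ≤⟨ expected-≤ ps _ 0≤ps sizes ⟩
  sumℚ ps ℚ.* ofℕ (1 + n * 5)        ≡⟨ cong (ℚ._* ofℕ (1 + n * 5)) Σps≡1 ⟩
  1ℚ ℚ.* ofℕ (1 + n * 5)             ≡⟨ ℚ.*-identityˡ (ofℕ (1 + n * 5)) ⟩
  ofℕ (1 + n * 5)                    ∎
  where
  open ℚ.≤-Reasoning
  sizes : SizesAtMost (1 + n * 5) (run k (adversary n))
  sizes = SizesAtMost-≼ (run-≼ (ℕ.m≤n+m k 4) (adversary n)) (run-adversary-sizes k n)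

theorem4 : (k : ℕ) (ps : Vec ℚ k) → IsDistribution ps →
    (γ : ℚ) → (+ 5) / 9 < γ → ¬ AchievesGuarantee k ps γ
theorem4 k ps distribution γ 5/9<γ achieves = ℕ.<-irrefl refl (ℚ-bound⇒≤denominator γ m 5/9<γ γ9m≤1+5m)
  where
  m : ℕ
  m = suc (ℚ.↧ₙ γ)
  G : List Edge
  G = adversary m
  all-arrived : List.take (length G) G ≡ G
  all-arrived = List.take-all (length G) G ℕ.≤-refl
  guarantee : γ ℚ.* ofℕ (length (matching m)) ℚ.≤ expected ps (run k G)
  guarantee = subst (λ H → γ ℚ.* ofℕ (length (matching m)) ℚ.≤ expected ps (run k H)) all-arrived
    (achieves G (adversary-simple m) (adversary-forest m) (adversary-maxDegree m) (length G) (matching m)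
      (subst (λ H → IsMaximumMatching H (matching m)) (sym all-arrived) (adversary-maximumMatching (ℚ.↧ₙ γ))))
  γ9m≤1+5m : γ ℚ.* ofℕ (m * 9) ℚ.≤ ofℕ (1 + m * 5)
  γ9m≤1+5m = subst (λ x → γ ℚ.* ofℕ x ℚ.≤ ofℕ (1 + m * 5)) (length-matching m)
                   (ℚ.≤-trans guarantee (expected-adversary-≤ ps distribution m))
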